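{- Let $k\ge2$ and $n$ be positive integers with $k\le n\le k^5-1$, and let $\vec{B}\in\mathbb{F}_2^{k\times n}$ be a proper basis such that for every $i<k$, \[d_{\min}(\mathcal{C}(\vec{B}_{[i,k]}))\ge\frac{n'-k'}{10\log k'},\] where $n':=|\mathsf{Supp}(\vec{B}_{[i,k]})|$ and $k':=k-i+1$. Then for all $i\in[k]$, \[|\mathsf{Supp}(\mathcal{C}(\vec{B}_{[i,k]}))|\le k+e^{ -(i-1)/(10\log k)}\cdot(n-k).\]
   Context: $\log$ is base 2. $\mathcal{C}(\vec{M})$ is the row span; $\mathsf{Supp}$ of a code or matrix is the union of supports of its (row-span) vectors; $d_{\min}$ is minimum nonzero Hamming weight. $\pi^\perp_{\{\vec{x}_1,\dots,\vec{x}_m\}}$ zeroes coordinates in the union of supports; $\pi_i:=\pi^\perp_{\{\vec{b}_1,\dots,\vec{b}_{i-1}\}}$, $\vec{b}_i^+:=\pi_i(\vec{b}_i)$, $\vec{B}_{[i,j]}:=(\pi_i(\vec{b}_i);\dots;\pi_i(\vec{b}_j))$. Proper: all $\vec{b}_i^+\ne\vec0$. -}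

module Defs where

open import Data.Bool using (Bool; true; false; _∧_; _∨_; not; _xor_; if_then_else_)
open import Data.Nat using (ℕ; zero; suc; _+_; _*_; _∸_; _^_; _≤_; _<_; _!)
open import Data.Nat.Properties using (_!≢0)
open import Data.Nat.DivMod using (_/_)
open import Data.Fin using (Fin; toℕ)
open import Data.Fin.Subset using (Subset; _∈_)
open import Data.Product using (∃; _×_)
open import Relation.Binary.PropositionalEquality using (_≡_)
open import Function.Bundles using (_⇔_)
open import Relation.Nullary using (¬_)

-- Vectors over F₂ are functions Fin n → Bool (true = 1, xor = addition).
Vecℱ : ℕ → Set
Vecℱ n = Fin n → Bool

-- A k × n matrix over F₂: row j is B j.  Rows/indices are 0-based:
-- the paper's row b_{i} is B (i-1).
Mat : ℕ → ℕ → Set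
Mat k n = Fin k → Vecℱ n

xorSum : ∀ {m} → (Fin m → Bool) → Bool
xorSum {zero}  f = false
xorSum {suc m} f = f Fin.zero xor xorSum {m} (λ j → f (Fin.suc j))
  where import Data.Fin as Fin

orSum : ∀ {m} → (Fin m → Bool) → Bool
orSum {zero}  f = false
orSum {suc m} f = f Fin.zero ∨ orSum {m} (λ j → f (Fin.suc j))
  where import Data.Fin as Fin

countTrue : ∀ {m} → (Fin m → Bool) → ℕ
countTrue {zero}  f = 0
countTrue {suc m} f = (if f Fin.zero then 1 else 0) + countTrue {m} (λ j → f (Fin.suc j))
  where import Data.Fin as Fin

wt : ∀ {n} → Vecℱ n → ℕ
wt v = countTrue v

IsZero : ∀ {n} → Vecℱ n → Set
IsZero v = ∀ l → v l ≡ false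

-- π_{i+1} (0-based i): zero out the coordinates in the union of the
-- supports of the rows B 0, …, B (i-1)  (the paper's b_1,…,b_i-1).
π : ∀ {k n} → Mat k n → Fin k → Vecℱ n → Vecℱ n
π B i v l = v l ∧ not (orSum (λ j → (toℕ j Data.Nat.<ᵇ toℕ i) ∧ B j l))
  where import Data.Nat

Proper : ∀ {k n} → Mat k n → Set
Proper B = ∀ i → ¬ IsZero (π B i (B i))

LinIndep : ∀ {k n} → Mat k n → Set
LinIndep B = ∀ (c : Vecℱ _) → IsZero (λ l → xorSum (λ j → c j ∧ B j l)) → ∀ j → c j ≡ false

-- The matrix B_{[i,k]} (0-based i, rows π_i(b_j) for j ≥ i), kept as the family of
-- rows indexed by Fin k with the rows j < i discarded; its row span is
-- { subCombo B i c | c ∈ F₂^k } : the coefficient c j is ignored for j < i.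
subCombo : ∀ {k n} → Mat k n → Fin k → Vecℱ k → Vecℱ n
subCombo B i c l = xorSum (λ j → c j ∧ (toℕ i Data.Nat.≤ᵇ toℕ j) ∧ π B i (B j) l)
  where import Data.Nat

suppSub : ∀ {k n} → Mat k n → Fin k → Vecℱ n
suppSub B i l = orSum (λ j → (toℕ i Data.Nat.≤ᵇ toℕ j) ∧ π B i (B j) l)
  where import Data.Nat

n′ : ∀ {k n} → Mat k n → Fin k → ℕ
n′ B i = countTrue (suppSub B i)

IsCodeSupp : ∀ {k n} → Mat k n → Fin k → Subset n → Set
IsCodeSupp B i T = ∀ l → (l ∈ T) ⇔ ∃ (λ c → subCombo B i c l ≡ true)

-- Partial sums of the exponential series, with denominators cleared:
-- for x y N with y > 0,
--   expNum x y N = Σ_{j=0}^{N} x^j · y^(N-j) · N!/j!   and   expDen y N = y^N · N!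
-- so that expNum x y N / expDen y N = Σ_{j=0}^{N} (x/y)^j / j!.
sumTo : ℕ → (ℕ → ℕ) → ℕ
sumTo zero    f = f 0
sumTo (suc N) f = sumTo N f + f (suc N)

ratio! : ℕ → ℕ → ℕ
ratio! N j = _/_ (N !) (j !) {{j !≢0}}

expNum : ℕ → ℕ → ℕ → ℕ
expNum x y N = sumTo N (λ j → x ^ j * y ^ (N ∸ j) * ratio! N j)

expDen : ℕ → ℕ → ℕ
expDen y N = y ^ N * N !

-- "m · e^(x/y) ≤ c"  (y > 0), since e^(x/y) = sup_N of the partial sums.
MulExpLe : ℕ → ℕ → ℕ → ℕ → Set
MulExpLe m x y c = ∀ N → m * expNum x y N ≤ c * expDen y N

-- "log₂ k < a / b"   (b > 0)  ⇔  k^b < 2^a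
Log2Lt : ℕ → ℕ → ℕ → Set
Log2Lt k a b = k ^ b < 2 ^ a

-- Write E m = |Supp(B_[m,k])| − k.  The support of B_[m+1,k] is contained in that of B_[m,k] and
-- misses the support of b_m^+, a codeword of C(B_[m,k]); the distance hypothesis bounds its weight
-- from below by E m / (10 log k), so E (m+1) ≤ (1 − x) E m for every x = b/(10a) with log k < a/b.
-- Hence E i ≤ (1 − x)^(i−1) (n − k), and (1 − x)^m e^(mx) ≤ 1 because e^(mx) is dominated coefficientwise
-- by (1 − x)^(−m) = Σ_j C(m+j−1, j) x^j, as m^j ≤ m (m+1) ⋯ (m+j−1).
module Submission where

open import Defs
open import Data.Nat using (ℕ; suc; _+_; _*_; _∸_; _^_; _≤_; _<_)
open import Data.Fin using (Fin; toℕ)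
open import Data.Fin.Subset using (Subset; ∣_∣)
open import Relation.Nullary using (¬_)

open import Data.Bool using (Bool; true; false; _∧_; not; _xor_; if_then_else_)
open import Data.Bool.Properties using (∧-conicalˡ; ∧-conicalʳ; ∧-zeroʳ; ∨-zeroʳ; xor-identityʳ; not-injective; T-≡)
open import Data.Nat using (zero; z≤n; s≤s; _!; _≤ᵇ_; _<ᵇ_; NonZero; >-nonZero)
open import Data.Nat.Properties
open import Data.Nat.DivMod using (m/n*n≤m)
open import Data.Nat.Tactic.RingSolver using (solve-∀)
open import Data.Fin using (fromℕ<) renaming (zero to fzero; suc to fsuc)
open import Data.Fin.Properties using (toℕ<n; toℕ-fromℕ<) renaming (_≟_ to _≟ᶠ_; suc-injective to fsuc-injective)
open import Data.Vec using ([]; _∷_; lookup)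
open import Data.Vec.Properties using ([]=⇒lookup; lookup⇒[]=)
open import Data.Product using (∃; _×_; _,_; proj₁)
open import Relation.Nullary using (does)
open import Relation.Nullary.Decidable using (dec-true; dec-false)
open import Relation.Binary.PropositionalEquality
open import Function.Base using (_∘_)
open import Function.Bundles using (Equivalence)
open Equivalence using (to; from)

-- Truncated exponential series

sumTo-cong : ∀ N {f g : ℕ → ℕ} → (∀ j → j ≤ N → f j ≡ g j) → sumTo N f ≡ sumTo N g
sumTo-cong zero    f≡g = f≡g 0 z≤n
sumTo-cong (suc N) f≡g =
  cong₂ _+_ (sumTo-cong N (λ j j≤N → f≡g j (m≤n⇒m≤1+n j≤N))) (f≡g (suc N) ≤-refl)

sumTo-mono-≤ : ∀ N {f g : ℕ → ℕ} → (∀ j → f j ≤ g j) → sumTo N f ≤ sumTo N g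
sumTo-mono-≤ zero    f≤g = f≤g 0
sumTo-mono-≤ (suc N) f≤g = +-mono-≤ (sumTo-mono-≤ N f≤g) (f≤g (suc N))

sumTo-*ˡ : ∀ N c (f : ℕ → ℕ) → sumTo N (λ j → c * f j) ≡ c * sumTo N f
sumTo-*ˡ zero    c f = refl
sumTo-*ˡ (suc N) c f =
  trans (cong (_+ c * f (suc N)) (sumTo-*ˡ N c f)) (sym (*-distribˡ-+ c (sumTo N f) (f (suc N))))

horner : ℕ → (ℕ → ℕ) → ℕ → ℕ
horner y h zero    = h 0
horner y h (suc N) = y * horner y h N + h (suc N)

sumTo≡horner : ∀ y h N → sumTo N (λ j → h j * y ^ (N ∸ j)) ≡ horner y h N
sumTo≡horner y h zero    = *-identityʳ (h 0)
sumTo≡horner y h (suc N) = cong₂ _+_ shifted (trans (cong (λ e → h (suc N) * y ^ e) (n∸n≡0 N))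
                                                     (*-identityʳ (h (suc N))))
  where
  open ≡-Reasoning
  swap : ∀ a y p → a * (y * p) ≡ y * (a * p)
  swap = solve-∀
  shifted : sumTo N (λ j → h j * y ^ (suc N ∸ j)) ≡ y * horner y h N
  shifted = begin
    sumTo N (λ j → h j * y ^ (suc N ∸ j))  ≡⟨ sumTo-cong N (λ j j≤N → trans (cong (λ e → h j * y ^ e) (+-∸-assoc 1 j≤N))
                                                                             (swap (h j) y (y ^ (N ∸ j)))) ⟩
    sumTo N (λ j → y * (h j * y ^ (N ∸ j)))  ≡⟨ sumTo-*ˡ N y _ ⟩
    y * sumTo N (λ j → h j * y ^ (N ∸ j))    ≡⟨ cong (y *_) (sumTo≡horner y h N) ⟩
    y * horner y h N                          ∎

-- multichoose i j = C(i+j−1, j), the j-th Taylor coefficient of (1 − x)^(−i).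
multichoose : ℕ → ℕ → ℕ
multichoose zero    zero    = 1
multichoose zero    (suc j) = 0
multichoose (suc i) zero    = 1
multichoose (suc i) (suc j) = multichoose (suc i) j + multichoose i (suc j)

multichoose-zeroʳ : ∀ i → multichoose i 0 ≡ 1
multichoose-zeroʳ zero    = refl
multichoose-zeroʳ (suc i) = refl

[1+i]^[1+j]≤i^[1+j]+[1+j]*[1+i]^j : ∀ i j → suc i ^ suc j ≤ i ^ suc j + suc j * suc i ^ j
[1+i]^[1+j]≤i^[1+j]+[1+j]*[1+i]^j i zero    = ≤-reflexive (linear i)
  where linear : ∀ i → suc i * 1 ≡ i * 1 + 1 * 1
        linear = solve-∀
[1+i]^[1+j]≤i^[1+j]+[1+j]*[1+i]^j i (suc j) = begin
  suc i * suc i ^ suc j                      ≤⟨ *-monoʳ-≤ (suc i) ([1+i]^[1+j]≤i^[1+j]+[1+j]*[1+i]^j i j) ⟩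
  suc i * (P + suc j * Q)                    ≡⟨ expand i j P Q ⟩
  i * P + (P + suc j * (suc i * Q))          ≤⟨ +-monoʳ-≤ (i * P) (+-monoˡ-≤ _ (^-monoˡ-≤ (suc j) (n≤1+n i))) ⟩
  i * P + (suc i * Q + suc j * (suc i * Q))  ≡⟨ cong (i * P +_) (collect i j Q) ⟩
  i * P + suc (suc j) * (suc i * Q)          ∎
  where
  open ≤-Reasoning
  P = i ^ suc j
  Q = suc i ^ j
  expand : ∀ i j P Q → suc i * (P + suc j * Q) ≡ i * P + (P + suc j * (suc i * Q))
  expand = solve-∀
  collect : ∀ i j Q → suc i * Q + suc j * (suc i * Q) ≡ suc (suc j) * (suc i * Q)
  collect = solve-∀

^≤multichoose*! : ∀ i j → i ^ j ≤ multichoose i j * j !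
^≤multichoose*! zero    zero    = ≤-refl
^≤multichoose*! zero    (suc j) = z≤n
^≤multichoose*! (suc i) zero    = ≤-refl
^≤multichoose*! (suc i) (suc j) = begin
  suc i ^ suc j                                       ≤⟨ [1+i]^[1+j]≤i^[1+j]+[1+j]*[1+i]^j i j ⟩
  i ^ suc j + suc j * suc i ^ j                       ≤⟨ +-mono-≤ (^≤multichoose*! i (suc j))
                                                                  (*-monoʳ-≤ (suc j) (^≤multichoose*! (suc i) j)) ⟩
  multichoose i (suc j) * (suc j * j !) + suc j * (multichoose (suc i) j * j !)
                                                      ≡⟨ collect (multichoose i (suc j)) (multichoose (suc i) j) j (j !) ⟩
  multichoose (suc i) (suc j) * (suc j * j !)         ∎
  where
  open ≤-Reasoning
  collect : ∀ a b j f → a * (suc j * f) + suc j * (b * f) ≡ (b + a) * (suc j * f)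
  collect = solve-∀

-- y^N times the truncation at degree N of (1 − s/y)^(−i) = Σ_j multichoose i j (s/y)^j.
multichooseSeries : ℕ → ℕ → ℕ → ℕ → ℕ
multichooseSeries s y i = horner y (λ j → multichoose i j * s ^ j)

multichooseSeries-zero : ∀ s y N → multichooseSeries s y 0 N ≡ y ^ N
multichooseSeries-zero s y zero    = refl
multichooseSeries-zero s y (suc N) =
  trans (cong (λ t → y * t + 0 * (s * s ^ N)) (multichooseSeries-zero s y N)) (+-identityʳ (y * y ^ N))

multichooseSeries-suc : ∀ s y i N →
  multichooseSeries s y (suc i) (suc N) ≡ s * multichooseSeries s y (suc i) N + multichooseSeries s y i (suc N)
multichooseSeries-suc s y i zero rewrite multichoose-zeroʳ i = shuffle y s (multichoose i 1)
  where shuffle : ∀ y s c → y * (1 * 1) + (1 + c) * (s * 1) ≡ s * (1 * 1) + (y * (1 * 1) + c * (s * 1))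
        shuffle = solve-∀
multichooseSeries-suc s y i (suc N) =
  trans (cong (λ t → y * t + multichoose (suc i) (suc (suc N)) * s ^ suc (suc N)) (multichooseSeries-suc s y i N))
        (shuffle y s (multichooseSeries s y (suc i) N) (multichooseSeries s y i (suc N))
                 (multichoose (suc i) (suc N)) (multichoose i (suc (suc N))) (s ^ suc N))
  where shuffle : ∀ y s X V c₁ c₂ p →
                  y * (s * X + V) + (c₁ + c₂) * (s * p) ≡ s * (y * X + c₁ * p) + (y * V + c₂ * (s * p))
        shuffle = solve-∀

-- The truncated form of (1 − s/y) (1 − s/y)^(−(i+1)) = (1 − s/y)^(−i): truncation only loses terms.
multichooseSeries-step : ∀ s u y → s + u ≡ y → ∀ i N →
  u * multichooseSeries s y (suc i) N ≤ y * multichooseSeries s y i N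
multichooseSeries-step s u y s+u≡y i zero rewrite multichoose-zeroʳ i | sym s+u≡y = *-monoˡ-≤ (1 * 1) (m≤n+m u s)
multichooseSeries-step s u y s+u≡y i (suc N) = +-cancelˡ-≤ (s * W₁) _ _ (begin
  s * W₁ + u * W₁                ≡⟨ sym (*-distribʳ-+ W₁ s u) ⟩
  (s + u) * W₁                   ≡⟨ cong (_* W₁) s+u≡y ⟩
  y * W₁                         ≡⟨ cong (y *_) (multichooseSeries-suc s y i N) ⟩
  y * (s * X + W₀)               ≡⟨ expand y s X W₀ ⟩
  s * (y * X) + y * W₀           ≤⟨ +-monoˡ-≤ (y * W₀) (*-monoʳ-≤ s (m≤m+n (y * X) _)) ⟩
  s * W₁ + y * W₀                ∎)
  where
  open ≤-Reasoning
  W₁ = multichooseSeries s y (suc i) (suc N)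
  X  = multichooseSeries s y (suc i) N
  W₀ = multichooseSeries s y i (suc N)
  expand : ∀ y s X V → y * (s * X + V) ≡ s * (y * X) + y * V
  expand = solve-∀

multichooseSeries-bound : ∀ s u y → s + u ≡ y → ∀ i N →
  u ^ i * multichooseSeries s y i N ≤ y ^ i * y ^ N
multichooseSeries-bound s u y s+u≡y zero N rewrite multichooseSeries-zero s y N = ≤-refl
multichooseSeries-bound s u y s+u≡y (suc i) N = begin
  u * u ^ i * multichooseSeries s y (suc i) N    ≡⟨ swap u (u ^ i) _ ⟩
  u ^ i * (u * multichooseSeries s y (suc i) N)  ≤⟨ *-monoʳ-≤ (u ^ i) (multichooseSeries-step s u y s+u≡y i N) ⟩
  u ^ i * (y * multichooseSeries s y i N)        ≡⟨ swap′ (u ^ i) y _ ⟩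
  y * (u ^ i * multichooseSeries s y i N)        ≤⟨ *-monoʳ-≤ y (multichooseSeries-bound s u y s+u≡y i N) ⟩
  y * (y ^ i * y ^ N)                            ≡⟨ sym (*-assoc y (y ^ i) (y ^ N)) ⟩
  y * y ^ i * y ^ N                              ∎
  where
  open ≤-Reasoning
  swap : ∀ u p w → u * p * w ≡ p * (u * w)
  swap = solve-∀
  swap′ : ∀ p y w → p * (y * w) ≡ y * (p * w)
  swap′ = solve-∀

^-distribʳ-* : ∀ m n o → (m * n) ^ o ≡ m ^ o * n ^ o
^-distribʳ-* m n zero    = refl
^-distribʳ-* m n (suc o) = trans (cong (m * n *_) (^-distribʳ-* m n o)) (shuffle m n (m ^ o) (n ^ o))
  where shuffle : ∀ a b p q → a * b * (p * q) ≡ a * p * (b * q)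
        shuffle = solve-∀

expNum-term≤ : ∀ s y i N j →
  (i * s) ^ j * y ^ (N ∸ j) * ratio! N j ≤ N ! * (multichoose i j * s ^ j * y ^ (N ∸ j))
expNum-term≤ s y i N j = begin
  (i * s) ^ j * Y * r                    ≡⟨ cong (λ z → z * Y * r) (^-distribʳ-* i s j) ⟩
  i ^ j * s ^ j * Y * r                  ≡⟨ regroup (i ^ j) (s ^ j) Y r ⟩
  (i ^ j * r) * (s ^ j * Y)              ≤⟨ *-monoˡ-≤ (s ^ j * Y) (*-monoˡ-≤ r (^≤multichoose*! i j)) ⟩
  (c * j ! * r) * (s ^ j * Y)            ≡⟨ cong (_* (s ^ j * Y)) (regroup′ c (j !) r) ⟩
  (c * (r * j !)) * (s ^ j * Y)          ≤⟨ *-monoˡ-≤ (s ^ j * Y) (*-monoʳ-≤ c (m/n*n≤m (N !) (j !) {{j !≢0}})) ⟩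
  (c * N !) * (s ^ j * Y)                ≡⟨ regroup″ c (N !) (s ^ j) Y ⟩
  N ! * (c * s ^ j * Y)                  ∎
  where
  open ≤-Reasoning
  Y = y ^ (N ∸ j)
  r = ratio! N j
  c = multichoose i j
  regroup : ∀ p q Y r → p * q * Y * r ≡ (p * r) * (q * Y)
  regroup = solve-∀
  regroup′ : ∀ c f r → c * f * r ≡ c * (r * f)
  regroup′ = solve-∀
  regroup″ : ∀ c f q Y → (c * f) * (q * Y) ≡ f * (c * q * Y)
  regroup″ = solve-∀

expNum≤!*multichooseSeries : ∀ s y i N → expNum (i * s) y N ≤ N ! * multichooseSeries s y i N
expNum≤!*multichooseSeries s y i N = begin
  expNum (i * s) y N                                                  ≤⟨ sumTo-mono-≤ N (expNum-term≤ s y i N) ⟩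
  sumTo N (λ j → N ! * (multichoose i j * s ^ j * y ^ (N ∸ j)))       ≡⟨ sumTo-*ˡ N (N !) _ ⟩
  N ! * sumTo N (λ j → multichoose i j * s ^ j * y ^ (N ∸ j))         ≡⟨ cong (N ! *_) (sumTo≡horner y _ N) ⟩
  N ! * multichooseSeries s y i N                                     ∎
  where open ≤-Reasoning

[1-x]^i*e^[ix]≤1 : ∀ s u y → s + u ≡ y → ∀ i N → u ^ i * expNum (i * s) y N ≤ y ^ i * expDen y N
[1-x]^i*e^[ix]≤1 s u y s+u≡y i N = begin
  u ^ i * expNum (i * s) y N            ≤⟨ *-monoʳ-≤ (u ^ i) (expNum≤!*multichooseSeries s y i N) ⟩
  u ^ i * (N ! * W)                     ≡⟨ swap (u ^ i) (N !) W ⟩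
  N ! * (u ^ i * W)                     ≤⟨ *-monoʳ-≤ (N !) (multichooseSeries-bound s u y s+u≡y i N) ⟩
  N ! * (y ^ i * y ^ N)                 ≡⟨ regroup (N !) (y ^ i) (y ^ N) ⟩
  y ^ i * (y ^ N * N !)                 ∎
  where
  open ≤-Reasoning
  W = multichooseSeries s y i N
  swap : ∀ p f w → p * (f * w) ≡ f * (p * w)
  swap = solve-∀
  regroup : ∀ f a b → f * (a * b) ≡ a * (b * f)
  regroup = solve-∀

-- Finite families of bits

bit : Bool → ℕ
bit b = if b then 1 else 0

bit-disjoint-≤ : ∀ a b c → (a ≡ true → c ≡ true) → (b ≡ true → c ≡ true) → (b ≡ true → a ≡ false) →
  bit a + bit b ≤ bit c
bit-disjoint-≤ false false c     _   _   _    = z≤n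
bit-disjoint-≤ true  false true  _   _   _    = ≤-refl
bit-disjoint-≤ false true  true  _   _   _    = ≤-refl
bit-disjoint-≤ true  true  c     _   _   b⇒¬a with () ← b⇒¬a refl
bit-disjoint-≤ true  false false a⇒c _   _    with () ← a⇒c refl
bit-disjoint-≤ false true  false _   b⇒c _    with () ← b⇒c refl

∧≡true : ∀ {a b} → a ∧ b ≡ true → a ≡ true × b ≡ true
∧≡true a∧b = ∧-conicalˡ _ _ a∧b , ∧-conicalʳ _ _ a∧b

≡true⇔⇒≡ : ∀ {a b} → (a ≡ true → b ≡ true) → (b ≡ true → a ≡ true) → a ≡ b
≡true⇔⇒≡ {true}  a⇒b _   = sym (a⇒b refl)
≡true⇔⇒≡ {false} {true}  _ b⇒a = b⇒a refl
≡true⇔⇒≡ {false} {false} _ _   = refl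

≡false-contrapositive : ∀ {a b} → (a ≡ true → b ≡ true) → b ≡ false → a ≡ false
≡false-contrapositive {false} _   _    = refl
≡false-contrapositive {true}  a⇒b b≡false with () ← trans (sym (a⇒b refl)) b≡false

countTrue-cong : ∀ {m} {f g : Fin m → Bool} → (∀ l → f l ≡ g l) → countTrue f ≡ countTrue g
countTrue-cong {zero}  f≡g = refl
countTrue-cong {suc m} f≡g = cong₂ _+_ (cong bit (f≡g fzero)) (countTrue-cong (λ l → f≡g (fsuc l)))

countTrue≤ : ∀ {m} (f : Fin m → Bool) → countTrue f ≤ m
countTrue≤ {zero}  f = z≤n
countTrue≤ {suc m} f with f fzero
... | true  = s≤s (countTrue≤ (λ j → f (fsuc j)))
... | false = m≤n⇒m≤1+n (countTrue≤ (λ j → f (fsuc j)))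

countTrue-+-≤ : ∀ {m} (f g h : Fin m → Bool) → (∀ l → bit (f l) + bit (g l) ≤ bit (h l)) →
  countTrue f + countTrue g ≤ countTrue h
countTrue-+-≤ {zero}  f g h _   = z≤n
countTrue-+-≤ {suc m} f g h f+g≤h = begin
  (bit (f fzero) + F) + (bit (g fzero) + G)  ≡⟨ +-assoc-interchange (bit (f fzero)) F (bit (g fzero)) G ⟩
  (bit (f fzero) + bit (g fzero)) + (F + G)  ≤⟨ +-mono-≤ (f+g≤h fzero) (countTrue-+-≤ _ _ _ (λ l → f+g≤h (fsuc l))) ⟩
  bit (h fzero) + countTrue (λ j → h (fsuc j)) ∎
  where
  open ≤-Reasoning
  F = countTrue (λ j → f (fsuc j))
  G = countTrue (λ j → g (fsuc j))
  +-assoc-interchange : ∀ a b c d → (a + b) + (c + d) ≡ (a + c) + (b + d)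
  +-assoc-interchange = solve-∀

orSum-witness : ∀ {m} (f : Fin m → Bool) → orSum f ≡ true → ∃ λ j → f j ≡ true
orSum-witness {suc m} f any with f fzero in f₀
... | true  = fzero , f₀
... | false with orSum-witness (λ j → f (fsuc j)) any
...   | j , fj = fsuc j , fj

orSum-true : ∀ {m} (f : Fin m → Bool) j → f j ≡ true → orSum f ≡ true
orSum-true f fzero    fj rewrite fj = refl
orSum-true f (fsuc j) fj rewrite orSum-true (λ j → f (fsuc j)) j fj = ∨-zeroʳ (f fzero)

orSum-false : ∀ {m} (f : Fin m → Bool) → (∀ j → f j ≡ false) → orSum f ≡ false
orSum-false {zero}  f _    = refl
orSum-false {suc m} f none rewrite none fzero = orSum-false (λ j → f (fsuc j)) (λ j → none (fsuc j))

xorSum-false : ∀ {m} (f : Fin m → Bool) → (∀ j → f j ≡ false) → xorSum f ≡ false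
xorSum-false {zero}  f _    = refl
xorSum-false {suc m} f none rewrite none fzero = xorSum-false (λ j → f (fsuc j)) (λ j → none (fsuc j))

xorSum-∧≡true⇒orSum≡true : ∀ {m} (c g : Fin m → Bool) → xorSum (λ j → c j ∧ g j) ≡ true → orSum g ≡ true
xorSum-∧≡true⇒orSum≡true {suc m} c g odd with c fzero | g fzero
... | _     | true  = refl
... | true  | false = xorSum-∧≡true⇒orSum≡true (λ j → c (fsuc j)) (λ j → g (fsuc j)) odd
... | false | false = xorSum-∧≡true⇒orSum≡true (λ j → c (fsuc j)) (λ j → g (fsuc j)) odd

xorSum-concentrated : ∀ {m} (f : Fin m → Bool) j → (∀ j′ → j′ ≢ j → f j′ ≡ false) → xorSum f ≡ f j
xorSum-concentrated f fzero    off = trans (cong (f fzero xor_) (xorSum-false _ (λ j → off (fsuc j) (λ ()))))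
                                           (xor-identityʳ (f fzero))
xorSum-concentrated f (fsuc j) off rewrite off fzero (λ ()) =
  xorSum-concentrated (λ j → f (fsuc j)) j (λ j′ j′≢j → off (fsuc j′) (j′≢j ∘ fsuc-injective))

unitVec : ∀ {m} → Fin m → Vecℱ m
unitVec j j′ = does (j′ ≟ᶠ j)

xorSum-unitVec-∧ : ∀ {m} (g : Fin m → Bool) j → xorSum (λ j′ → unitVec j j′ ∧ g j′) ≡ g j
xorSum-unitVec-∧ g j = trans (xorSum-concentrated _ j (λ j′ j′≢j → cong (_∧ g j′) (dec-false (j′ ≟ᶠ j) j′≢j)))
                             (cong (_∧ g j) (dec-true (j ≟ᶠ j) refl))

∣∣≡countTrue-lookup : ∀ {n} (T : Subset n) → ∣ T ∣ ≡ countTrue (lookup T)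
∣∣≡countTrue-lookup []          = refl
∣∣≡countTrue-lookup (true ∷ T)  = cong suc (∣∣≡countTrue-lookup T)
∣∣≡countTrue-lookup (false ∷ T) = ∣∣≡countTrue-lookup T

-- Supports of the projected codes

subCombo-unitVec : ∀ {k n} (B : Mat k n) i l → subCombo B i (unitVec i) l ≡ π B i (B i) l
subCombo-unitVec B i l = trans (xorSum-unitVec-∧ _ i) (cong (_∧ π B i (B i) l) (to T-≡ (≤⇒≤ᵇ (≤-refl {toℕ i}))))

-- A coordinate lies in Supp(C(B_[i,k])) iff it lies in the support of a row of B_[i,k]: a row is
-- the codeword with a unit coefficient vector, and a sum is nonzero only where some summand is.
lookup-codeSupp≡suppSub : ∀ {k n} (B : Mat k n) i (T : Subset n) → IsCodeSupp B i T →
  ∀ l → lookup T l ≡ suppSub B i l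
lookup-codeSupp≡suppSub B i T T-supp l = ≡true⇔⇒≡ inSupp inT
  where
  inSupp : lookup T l ≡ true → suppSub B i l ≡ true
  inSupp l∈T with to (T-supp l) (lookup⇒[]= l T l∈T)
  ... | c , cl = xorSum-∧≡true⇒orSum≡true c _ cl
  inT : suppSub B i l ≡ true → lookup T l ≡ true
  inT inRow with orSum-witness _ inRow
  ... | j , jl = []=⇒lookup (from (T-supp l) (unitVec j , trans (xorSum-unitVec-∧ _ j) jl))

∣codeSupp∣≡n′ : ∀ {k n} (B : Mat k n) i (T : Subset n) → IsCodeSupp B i T → ∣ T ∣ ≡ n′ B i
∣codeSupp∣≡n′ B i T T-supp = trans (∣∣≡countTrue-lookup T) (countTrue-cong (lookup-codeSupp≡suppSub B i T T-supp))

coveredBefore : ∀ {k n} → Mat k n → ℕ → Vecℱ n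
coveredBefore B m l = orSum (λ j → (toℕ j <ᵇ m) ∧ B j l)

-- Supp(B_[m+1,k]) for a natural number m ≤ k; suppFrom B (toℕ i) is suppSub B i by definition.
suppFrom : ∀ {k n} → Mat k n → ℕ → Vecℱ n
suppFrom B m l = orSum (λ j → (m ≤ᵇ toℕ j) ∧ (B j l ∧ not (coveredBefore B m l)))

coveredBefore-suc : ∀ {k n} (B : Mat k n) m l → coveredBefore B m l ≡ true → coveredBefore B (suc m) l ≡ true
coveredBefore-suc B m l covered with orSum-witness (λ j → (toℕ j <ᵇ m) ∧ B j l) covered
... | j , jl with ∧≡true jl
...   | j<m , Bjl = orSum-true _ j (cong₂ _∧_ (to T-≡ (<⇒<ᵇ (m<n⇒m<1+n (<ᵇ⇒< (toℕ j) m (from T-≡ j<m))))) Bjl)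

suppFrom-suc⊆suppFrom : ∀ {k n} (B : Mat k n) m l → suppFrom B (suc m) l ≡ true → suppFrom B m l ≡ true
suppFrom-suc⊆suppFrom B m l inSupp
  with orSum-witness (λ j → (suc m ≤ᵇ toℕ j) ∧ (B j l ∧ not (coveredBefore B (suc m) l))) inSupp
... | j , jl with ∧≡true jl
...   | m<j , rest with ∧≡true rest
...     | Bjl , uncovered = orSum-true _ j (cong₂ _∧_ m≤j (cong₂ _∧_ Bjl (cong not uncoveredₘ)))
  where
  m≤j : (m ≤ᵇ toℕ j) ≡ true
  m≤j = to T-≡ (≤⇒≤ᵇ (<⇒≤ (≤ᵇ⇒≤ (suc m) (toℕ j) (from T-≡ m<j))))
  uncoveredₘ : coveredBefore B m l ≡ false
  uncoveredₘ = ≡false-contrapositive (coveredBefore-suc B m l) (not-injective uncovered)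

π-row⊆suppFrom : ∀ {k n} (B : Mat k n) i l → π B i (B i) l ≡ true → suppFrom B (toℕ i) l ≡ true
π-row⊆suppFrom B i l il = orSum-true _ i (trans (cong (_∧ π B i (B i) l) (to T-≡ (≤⇒≤ᵇ (≤-refl {toℕ i})))) il)

π-row∩suppFrom-suc≡false : ∀ {k n} (B : Mat k n) i l → π B i (B i) l ≡ true → suppFrom B (suc (toℕ i)) l ≡ false
π-row∩suppFrom-suc≡false B i l il = orSum-false _ uncovered
  where
  covered : coveredBefore B (suc (toℕ i)) l ≡ true
  covered = orSum-true _ i (cong₂ _∧_ (to T-≡ (<⇒<ᵇ (n<1+n (toℕ i)))) (proj₁ (∧≡true il)))
  uncovered : ∀ j → (suc (toℕ i) ≤ᵇ toℕ j) ∧ (B j l ∧ not (coveredBefore B (suc (toℕ i)) l)) ≡ false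
  uncovered j rewrite covered = trans (cong ((suc (toℕ i) ≤ᵇ toℕ j) ∧_) (∧-zeroʳ (B j l))) (∧-zeroʳ _)

countTrue-suppFrom-suc+wt≤ : ∀ {k n} (B : Mat k n) i →
  countTrue (suppFrom B (suc (toℕ i))) + wt (π B i (B i)) ≤ countTrue (suppFrom B (toℕ i))
countTrue-suppFrom-suc+wt≤ B i = countTrue-+-≤ (suppFrom B (suc (toℕ i))) (π B i (B i)) (suppFrom B (toℕ i)) (λ l →
  bit-disjoint-≤ _ _ _ (suppFrom-suc⊆suppFrom B (toℕ i) l) (π-row⊆suppFrom B i l) (π-row∩suppFrom-suc≡false B i l))

-- Decay of the excess support

^-cancelʳ-< : ∀ m .{{_ : NonZero m}} {x z} → m ^ x < m ^ z → x < z
^-cancelʳ-< m mˣ<mᶻ = ≰⇒> (λ z≤x → <⇒≱ mˣ<mᶻ (^-monoʳ-≤ m z≤x))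

^-cancelʳ-≤ : ∀ m → 1 < m → ∀ {x z} → m ^ x ≤ m ^ z → x ≤ z
^-cancelʳ-≤ m 1<m mˣ≤mᶻ = ≮⇒≥ (λ z<x → <⇒≱ (^-monoʳ-< m 1<m z<x) mˣ≤mᶻ)

weight-lower-bound : ∀ {A k k′ c w a b} → k′ ≤ k → 2 ^ (A ∸ k′) ≤ k′ ^ (c * w) → k ^ b < 2 ^ a →
  b * (A ∸ k) ≤ c * a * w
weight-lower-bound {A} {k} {k′} {c} {w} {a} {b} k′≤k distance k^b<2^a =
  subst (b * (A ∸ k) ≤_) (regroup a c w) (^-cancelʳ-≤ 2 (s≤s (s≤s z≤n)) (begin
    2 ^ (b * (A ∸ k))        ≤⟨ ^-monoʳ-≤ 2 (*-monoʳ-≤ b (∸-monoʳ-≤ A k′≤k)) ⟩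
    2 ^ (b * D)              ≡⟨ cong (2 ^_) (*-comm b D) ⟩
    2 ^ (D * b)              ≡⟨ sym (^-*-assoc 2 D b) ⟩
    (2 ^ D) ^ b              ≤⟨ ^-monoˡ-≤ b distance ⟩
    (k′ ^ (c * w)) ^ b       ≤⟨ ^-monoˡ-≤ b (^-monoˡ-≤ (c * w) k′≤k) ⟩
    (k ^ (c * w)) ^ b        ≡⟨ ^-*-assoc k (c * w) b ⟩
    k ^ (c * w * b)          ≡⟨ cong (k ^_) (*-comm (c * w) b) ⟩
    k ^ (b * (c * w))        ≡⟨ sym (^-*-assoc k b (c * w)) ⟩
    (k ^ b) ^ (c * w)        ≤⟨ ^-monoˡ-≤ (c * w) (<⇒≤ k^b<2^a) ⟩
    (2 ^ a) ^ (c * w)        ≡⟨ ^-*-assoc 2 a (c * w) ⟩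
    2 ^ (a * (c * w))        ∎))
  where
  open ≤-Reasoning
  D = A ∸ k′
  regroup : ∀ a c w → a * (c * w) ≡ c * a * w
  regroup = solve-∀

excess-contraction : ∀ {A A′ w k b u y} → A′ + w ≤ A → b * (A ∸ k) ≤ y * w → b + u ≡ y →
  y * (A′ ∸ k) ≤ u * (A ∸ k)
excess-contraction {A} {A′} {w} {k} {b} {u} {y} A′+w≤A weight b+u≡y = begin
  y * (A′ ∸ k)               ≤⟨ *-monoʳ-≤ y (∸-monoˡ-≤ k (m+n≤o⇒m≤o∸n A′ A′+w≤A)) ⟩
  y * (A ∸ w ∸ k)            ≡⟨ cong (y *_) (trans (∸-+-assoc A w k) (trans (cong (A ∸_) (+-comm w k)) (sym (∸-+-assoc A k w)))) ⟩
  y * (A ∸ k ∸ w)            ≡⟨ *-distribˡ-∸ y (A ∸ k) w ⟩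
  y * (A ∸ k) ∸ y * w        ≤⟨ ∸-monoʳ-≤ (y * (A ∸ k)) weight ⟩
  y * (A ∸ k) ∸ b * (A ∸ k)  ≡⟨ sym (*-distribʳ-∸ (A ∸ k) y b) ⟩
  (y ∸ b) * (A ∸ k)          ≡⟨ cong (λ t → (t ∸ b) * (A ∸ k)) (sym b+u≡y) ⟩
  (b + u ∸ b) * (A ∸ k)      ≡⟨ cong (_* (A ∸ k)) (m+n∸m≡n b u) ⟩
  u * (A ∸ k)                ∎
  where open ≤-Reasoning

geometric-decay : ∀ (E : ℕ → ℕ) {K y u} → (∀ m → suc m < K → y * E (suc m) ≤ u * E m) →
  ∀ m → m < K → y ^ m * E m ≤ u ^ m * E 0
geometric-decay E         step zero    _      = ≤-refl
geometric-decay E {y = y} {u} step (suc m) m+1<K = begin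
  y * y ^ m * E (suc m)      ≡⟨ swap y (y ^ m) (E (suc m)) ⟩
  y ^ m * (y * E (suc m))    ≤⟨ *-monoʳ-≤ (y ^ m) (step m m+1<K) ⟩
  y ^ m * (u * E m)          ≡⟨ swap′ (y ^ m) u (E m) ⟩
  u * (y ^ m * E m)          ≤⟨ *-monoʳ-≤ u (geometric-decay E step m (<-trans (n<1+n m) m+1<K)) ⟩
  u * (u ^ m * E 0)          ≡⟨ sym (*-assoc u (u ^ m) (E 0)) ⟩
  u * u ^ m * E 0            ∎
  where
  open ≤-Reasoning
  swap : ∀ y p e → y * p * e ≡ p * (y * e)
  swap = solve-∀
  swap′ : ∀ p u e → p * (u * e) ≡ u * (p * e)
  swap′ = solve-∀

*-≤-chain : ∀ p .{{_ : NonZero p}} {q e e₀ x d} → p * e ≤ q * e₀ → q * x ≤ p * d → e * x ≤ e₀ * d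
*-≤-chain p {q} {e} {e₀} {x} {d} pe≤qe₀ qx≤pd = *-cancelˡ-≤ p (begin
  p * (e * x)                ≡⟨ sym (*-assoc p e x) ⟩
  p * e * x                  ≤⟨ *-monoˡ-≤ x pe≤qe₀ ⟩
  q * e₀ * x                 ≡⟨ swap q e₀ x ⟩
  e₀ * (q * x)               ≤⟨ *-monoʳ-≤ e₀ qx≤pd ⟩
  e₀ * (p * d)               ≡⟨ swap′ e₀ p d ⟩
  p * (e₀ * d)               ∎)
  where
  open ≤-Reasoning
  swap : ∀ q e x → q * e * x ≡ e * (q * x)
  swap = solve-∀
  swap′ : ∀ e p d → e * (p * d) ≡ p * (e * d)
  swap′ = solve-∀

excess : ∀ {k n} → Mat k n → ℕ → ℕ
excess {k} B m = countTrue (suppFrom B m) ∸ k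

excess-step : ∀ {k n} (B : Mat k n) → Proper B →
  (∀ (i : Fin k) → suc (toℕ i) < k → ∀ c →
    ¬ IsZero (subCombo B i c) →
    2 ^ (n′ B i ∸ (k ∸ toℕ i)) ≤ (k ∸ toℕ i) ^ (10 * wt (subCombo B i c))) →
  ∀ {a b u} → k ^ b < 2 ^ a → b + u ≡ 10 * a →
  ∀ m → suc m < k → 10 * a * excess B (suc m) ≤ u * excess B m
excess-step {k} B proper distance {a} {b} {u} k^b<2^a b+u≡y m m+1<k =
  subst (λ t → 10 * a * excess B (suc t) ≤ u * excess B t) (toℕ-fromℕ< m<k)
    (excess-contraction {A′ = countTrue (suppFrom B (suc (toℕ i)))} {w = wt (π B i (B i))} {k = k} {b = b}
                        (countTrue-suppFrom-suc+wt≤ B i)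
                        (weight-lower-bound {c = 10} {a = a} {b = b} (m∸n≤m k (toℕ i)) rowDistance k^b<2^a) b+u≡y)
  where
  m<k = <-trans (n<1+n m) m+1<k
  i = fromℕ< m<k
  rowNonzero : ¬ IsZero (subCombo B i (unitVec i))
  rowNonzero vanishes = proper i (λ l → trans (sym (subCombo-unitVec B i l)) (vanishes l))
  rowDistance : 2 ^ (n′ B i ∸ (k ∸ toℕ i)) ≤ (k ∸ toℕ i) ^ (10 * wt (π B i (B i)))
  rowDistance = subst (λ w → 2 ^ (n′ B i ∸ (k ∸ toℕ i)) ≤ (k ∸ toℕ i) ^ (10 * w))
                      (countTrue-cong (subCombo-unitVec B i))
                      (distance i (subst (λ t → suc t < k) (sym (toℕ-fromℕ< m<k)) m+1<k) (unitVec i) rowNonzero)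

mainTheorem9 : (k n : ℕ) → 2 ≤ k → k ≤ n → n < k ^ 5 →
    (B : Mat k n) → LinIndep B → Proper B →
    (∀ (i : Fin k) → suc (toℕ i) < k → ∀ c →
      ¬ IsZero (subCombo B i c) →
      2 ^ (n′ B i ∸ (k ∸ toℕ i)) ≤ (k ∸ toℕ i) ^ (10 * wt (subCombo B i c))) →
    (∀ (i : Fin k) (T : Subset n) → IsCodeSupp B i T →
      ∀ (a b : ℕ) → 1 ≤ b → Log2Lt k a b →
      MulExpLe (∣ T ∣ ∸ k) (toℕ i * b) (10 * a) (n ∸ k))
mainTheorem9 k n 2≤k _ _ B _ proper distance i T T-supp a b _ k^b<2^a N
  rewrite ∣codeSupp∣≡n′ B i T T-supp =
  ≤-trans (*-≤-chain (y ^ m) {{m^n≢0 y m}} {q = u ^ m}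
                     (geometric-decay (excess B) (excess-step B proper distance {a} {b} {u} k^b<2^a b+u≡y) m (toℕ<n i))
                     ([1-x]^i*e^[ix]≤1 b u y b+u≡y m N))
          (*-monoˡ-≤ (expDen y N) (∸-monoˡ-≤ k (countTrue≤ (suppFrom B 0))))
  where
  m = toℕ i
  y = 10 * a
  u = y ∸ b
  b<a : b < a
  b<a = ^-cancelʳ-< 2 (≤-<-trans (^-monoˡ-≤ b 2≤k) k^b<2^a)
  instance
    y≢0 : NonZero y
    y≢0 = m*n≢0 10 a {{_}} {{>-nonZero (≤-<-trans z≤n b<a)}}
  b+u≡y : b + u ≡ y
  b+u≡y = m+[n∸m]≡n (≤-trans (<⇒≤ b<a) (m≤n*m a 10))
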